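{- Every discrete polymatroid is $M$-shellable. That is, if $\Gamma$ is a discrete polymatroid on variables $x_1,\ldots,x_r$, then the poset $\Gamma$ (ordered by divisibility) admits an $M$-shelling.
   Context: A monomial order ideal $\Gamma$ on variables $x_1,\ldots,x_r$ is a set of monomials $x_1^{a_1}\cdots x_r^{a_r}$ such that $u\in\Gamma$ and $v\mid u$ imply $v\in\Gamma$; it is regarded as a poset ordered by divisibility. It is pure if all its maximal elements have the same degree. For a monomial $m$, $m_i$ denotes the exponent of $x_i$ in $m$. A discrete polymatroid is a pure monomial order ideal $\Gamma$ such that for any two maximal monomials $m,m'\in\Gamma$ and any index $i$ with $m_i>m'_i$, there is an index $j$ with $m_j<m'_j$ and $\frac{x_j}{x_i}m\in\Gamma$. A poset is an $M$-poset if it is isomorphic to the set of monomials dividing some fixed monomial, ordered by divisibility (equivalently, a direct product of finite chains). For $x\le y$ in a poset $P$, the interval $[x,y]$ is an $M$-interval if it is an $M$-poset. An $M$-partition of a pure poset $P$ is a partition of $P$ into $M$-intervals $[x_1,y_1],\ldots,[x_n,y_n]$ with each $y_i$ a maximal element of $P$. An $M$-shelling of $P$ is an $M$-partition together with an ordering of its $M$-intervals such that the union of the elements of any initial subsequence of the intervals is an order ideal (down-closed subset) of $P$. $P$ is $M$-shellable if it admits an $M$-shelling. -}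

module Defs where

open import Data.Nat using (ℕ; suc; pred; _≤_; _<_)
open import Data.Fin using (Fin)
open import Data.Vec using (Vec; lookup; sum; _[_]%=_)
open import Data.List using (List; length; take)
open import Data.List.Membership.Propositional using (_∈_)
open import Data.List.Relation.Unary.Any using (Any)
open import Data.Product using (Σ; ∃; ∃-syntax; _×_; _,_)
open import Relation.Binary.PropositionalEquality using (_≡_)

-- A monomial x_1^{a_1} ... x_r^{a_r} is its exponent vector (a_1,...,a_r).
Monomial : ℕ → Set
Monomial r = Vec ℕ r

_∣ₘ_ : ∀ {r} → Monomial r → Monomial r → Set
u ∣ₘ v = ∀ i → lookup u i ≤ lookup v i

deg : ∀ {r} → Monomial r → ℕ
deg m = sum m

-- (x_j / x_i) m  (used only when m_i > 0)
shift : ∀ {r} → Fin r → Fin r → Monomial r → Monomial r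
shift i j m = (m [ i ]%= pred) [ j ]%= suc

MonSet : ℕ → Set
MonSet r = List (Monomial r)

IsOrderIdeal : ∀ {r} → MonSet r → Set
IsOrderIdeal Γ = ∀ u v → u ∈ Γ → v ∣ₘ u → v ∈ Γ

IsMaximal : ∀ {r} → MonSet r → Monomial r → Set
IsMaximal Γ m = m ∈ Γ × (∀ u → u ∈ Γ → m ∣ₘ u → u ≡ m)

IsPure : ∀ {r} → MonSet r → Set
IsPure Γ = ∀ m m' → IsMaximal Γ m → IsMaximal Γ m' → deg m ≡ deg m'

IsDiscretePolymatroid : ∀ {r} → MonSet r → Set
IsDiscretePolymatroid {r} Γ =
  IsOrderIdeal Γ × IsPure Γ ×
  (∀ m m' (i : Fin r) → IsMaximal Γ m → IsMaximal Γ m' →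
     lookup m' i < lookup m i →
     ∃[ j ] (lookup m j < lookup m' j × shift i j m ∈ Γ))

InInterval : ∀ {r} → MonSet r → Monomial r × Monomial r → Monomial r → Set
InInterval Γ (x , y) z = z ∈ Γ × x ∣ₘ z × z ∣ₘ y

-- The interval [x,y] of Γ is an M-poset: it is order-isomorphic to the
-- poset of divisors of some monomial w (in some number s of variables).
IsMInterval : ∀ {r} → MonSet r → Monomial r × Monomial r → Set
IsMInterval {r} Γ I =
  Σ ℕ λ s → Σ (Monomial s) λ w →
  Σ (Monomial r → Monomial s) λ φ → Σ (Monomial s → Monomial r) λ ψ →
    (∀ z → InInterval Γ I z → φ z ∣ₘ w) ×
    (∀ d → d ∣ₘ w → InInterval Γ I (ψ d)) ×
    (∀ z → InInterval Γ I z → ψ (φ z) ≡ z) ×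
    (∀ d → d ∣ₘ w → φ (ψ d) ≡ d) ×
    (∀ z z' → InInterval Γ I z → InInterval Γ I z' →
       (z ∣ₘ z' → φ z ∣ₘ φ z') × (φ z ∣ₘ φ z' → z ∣ₘ z'))

IsMPartition : ∀ {r} → MonSet r → List (Monomial r × Monomial r) → Set
IsMPartition Γ L =
  (∀ (k : Fin (length L)) → let (x , y) = Data.List.lookup L k in
     x ∈ Γ × x ∣ₘ y × IsMaximal Γ y × IsMInterval Γ (x , y)) ×
  (∀ z → z ∈ Γ → ∃[ k ] InInterval Γ (Data.List.lookup L k) z) ×
  (∀ z (k k' : Fin (length L)) → InInterval Γ (Data.List.lookup L k) z →
     InInterval Γ (Data.List.lookup L k') z → k ≡ k')

InUnion : ∀ {r} → MonSet r → List (Monomial r × Monomial r) → Monomial r → Set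
InUnion Γ L z = Any (λ I → InInterval Γ I z) L

IsMShelling : ∀ {r} → MonSet r → List (Monomial r × Monomial r) → Set
IsMShelling Γ L =
  IsMPartition Γ L ×
  (∀ n z v → InUnion Γ (take n L) z → v ∈ Γ → v ∣ₘ z → InUnion Γ (take n L) v)

IsMShellable : ∀ {r} → MonSet r → Set
IsMShellable {r} Γ = ∃[ L ] IsMShelling {r} Γ L

-- Let Γ be a discrete polymatroid of rank d; its maximal monomials (the
-- bases) are exactly the members of degree d.  List the bases in
-- decreasing lexicographic order b₁ ≻ b₂ ≻ ⋯.  For a basis b call the
-- coordinate j covered if b / x_j divides an earlier basis, and let
-- bottom b be the monomial with exponent b_j at covered coordinates and 0
-- elsewhere.  The intervals [bottom b , b], in this order, form the shelling.
--
-- The heart of the proof is the key lemma: if b' ≻ b are bases then some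
-- covered coordinate p of b has b'_p < b_p.  It is proved by induction on
-- the excess of b' over b, using the exchange axiom in both directions.
-- From it, a monomial z of Γ lies in [bottom b , b] exactly when b is the
-- first basis that z divides; this yields the partition and the shelling
-- property at once.  Intervals of an order ideal lying below a member are
-- boxes, hence M-posets.

module Submission where

open import Data.Nat using (ℕ; zero; suc; pred; _+_; _∸_; _≤_; _<_; z≤n; s≤s; z<s; _≤?_; _<?_)
open import Data.Nat.Properties
open import Data.Nat.Induction using (<-wellFounded)
open import Induction.WellFounded using (Acc; acc)
open import Data.Fin using (Fin; zero; suc)
import Data.Fin as Fin
import Data.Fin.Properties as FinP
open import Data.Vec using (Vec; []; _∷_; lookup; sum; _[_]%=_; tabulate; zipWith)
open import Data.Vec.Properties
  using (lookup∘updateAt; lookup∘updateAt′; lookup-zipWith; lookup∘tabulate; tabulate∘lookup; tabulate-cong)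
open import Data.List using (List; []; _∷_; length; take; filter; map; foldr)
import Data.List as List
open import Data.List.Membership.Propositional using (_∈_; find; lose)
open import Data.List.Membership.Propositional.Properties using (∈-map⁺; ∈-map⁻; ∈-filter⁺; ∈-filter⁻; ∈-lookup)
open import Data.List.Relation.Unary.Any using (Any; here; there)
import Data.List.Relation.Unary.Any as Any
open import Data.List.Relation.Unary.Any.Properties using (lookup-index)
open import Data.List.Relation.Unary.All using ([]; _∷_)
import Data.List.Relation.Unary.All as All
open import Data.List.Relation.Unary.AllPairs using (AllPairs; []; _∷_)
import Data.List.Relation.Unary.AllPairs.Properties as AllPairs
import Data.List.Relation.Binary.Sublist.Propositional as Sublist
open import Data.List.Relation.Binary.Sublist.Propositional.Properties using (take-⊆)
open import Data.List.Extrema.Nat using (argmax; argmax-all; f[xs]≤f[argmax])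
open import Data.Product using (∃-syntax; _×_; _,_; proj₁; proj₂)
open import Data.Sum using (_⊎_; inj₁; inj₂)
open import Data.Empty using (⊥; ⊥-elim)
open import Function using (_∘_; _on_)
open import Relation.Nullary using (¬_; Dec; yes; no; ¬?)
open import Relation.Nullary.Decidable using (_×-dec_)
open import Relation.Unary using (Decidable)
open import Relation.Binary using (Asymmetric; Transitive; Trichotomous; Tri; tri<; tri≈; tri>)
open import Relation.Binary.PropositionalEquality using (_≡_; _≢_; refl; sym; trans; cong; subst; subst₂; ≢-sym; module ≡-Reasoning)
open import Defs

-- Divisibility and degree of monomials

∣ₘ-refl : ∀ {r} {u : Monomial r} → u ∣ₘ u
∣ₘ-refl i = ≤-refl

∣ₘ-trans : ∀ {r} {u v w : Monomial r} → u ∣ₘ v → v ∣ₘ w → u ∣ₘ w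
∣ₘ-trans u∣v v∣w i = ≤-trans (u∣v i) (v∣w i)

_∣?_ : ∀ {r} (u v : Monomial r) → Dec (u ∣ₘ v)
u ∣? v = FinP.all? (λ i → lookup u i ≤? lookup v i)

monomial-ext : ∀ {r} {u v : Monomial r} → (∀ i → lookup u i ≡ lookup v i) → u ≡ v
monomial-ext {u = u} {v} same =
  trans (sym (tabulate∘lookup u)) (trans (tabulate-cong same) (tabulate∘lookup v))

deg-mono : ∀ {r} {u v : Monomial r} → u ∣ₘ v → deg u ≤ deg v
deg-mono {u = []} {[]} _ = z≤n
deg-mono {u = x ∷ u} {y ∷ v} u∣v = +-mono-≤ (u∣v zero) (deg-mono {u = u} {v} (u∣v ∘ suc))

deg-strict : ∀ {r} {u v : Monomial r} p → u ∣ₘ v → lookup u p < lookup v p → deg u < deg v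
deg-strict {u = x ∷ u} {y ∷ v} zero u∣v x<y = +-mono-<-≤ x<y (deg-mono {u = u} {v} (u∣v ∘ suc))
deg-strict {u = x ∷ u} {y ∷ v} (suc p) u∣v lt = +-mono-≤-< (u∣v zero) (deg-strict {u = u} {v} p (u∣v ∘ suc) lt)

divisor-of-same-degree : ∀ {r} {u v : Monomial r} → u ∣ₘ v → deg v ≤ deg u → u ≡ v
divisor-of-same-degree {u = u} {v} u∣v dv≤du = monomial-ext λ i →
  ≤-antisym (u∣v i) (≮⇒≥ λ lt → <⇒≱ (deg-strict {u = u} {v} i u∣v lt) dv≤du)

-- m / x_p (the exponent of x_p is lowered by one, if positive)
lower : ∀ {r} → Fin r → Monomial r → Monomial r
lower p m = m [ p ]%= pred

∣ₘ-raise : ∀ {r} (m : Monomial r) q → m ∣ₘ (m [ q ]%= suc)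
∣ₘ-raise m q k with k FinP.≟ q
... | yes refl = ≤-trans (n≤1+n _) (≤-reflexive (sym (lookup∘updateAt k m)))
... | no k≢q = ≤-reflexive (sym (lookup∘updateAt′ k q k≢q m))

∣ₘ-lower : ∀ {r} {z m : Monomial r} p → z ∣ₘ m → lookup z p < lookup m p → z ∣ₘ lower p m
∣ₘ-lower {z = z} {m} p z∣m zp<mp k with k FinP.≟ p
... | yes refl = subst (lookup z k ≤_) (sym (lookup∘updateAt k m)) (pred-mono-≤ zp<mp)
... | no k≢p = subst (lookup z k ≤_) (sym (lookup∘updateAt′ k p k≢p m)) (z∣m k)

module _ {r} {p q : Fin r} (m : Monomial r) where

  lookup-shift-source : p ≢ q → lookup (shift p q m) p ≡ pred (lookup m p)
  lookup-shift-source p≢q = trans (lookup∘updateAt′ p q p≢q (lower p m)) (lookup∘updateAt p m)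

  lookup-shift-target : p ≢ q → lookup (shift p q m) q ≡ suc (lookup m q)
  lookup-shift-target p≢q =
    trans (lookup∘updateAt q (lower p m)) (cong suc (lookup∘updateAt′ q p (≢-sym p≢q) m))

  lookup-shift-other : ∀ {k} → k ≢ p → k ≢ q → lookup (shift p q m) k ≡ lookup m k
  lookup-shift-other {k} k≢p k≢q = trans (lookup∘updateAt′ k q k≢q (lower p m)) (lookup∘updateAt′ k p k≢p m)

sum-raise : ∀ {n} (v : Vec ℕ n) q → sum (v [ q ]%= suc) ≡ suc (sum v)
sum-raise (x ∷ v) zero = refl
sum-raise (x ∷ v) (suc q) = trans (cong (x +_) (sum-raise v q)) (+-suc x (sum v))

sum-lower : ∀ {n} (v : Vec ℕ n) p → 0 < lookup v p → suc (sum (v [ p ]%= pred)) ≡ sum v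
sum-lower (suc x ∷ v) zero _ = refl
sum-lower (x ∷ v) (suc p) pos = trans (sym (+-suc x _)) (cong (x +_) (sum-lower v p pos))

deg-shift : ∀ {r} (m : Monomial r) p q → 0 < lookup m p → deg (shift p q m) ≡ deg m
deg-shift m p q pos = trans (sum-raise (lower p m) q) (sum-lower m p pos)

_≻_ : ∀ {n} → Vec ℕ n → Vec ℕ n → Set
[] ≻ [] = ⊥
(x ∷ xs) ≻ (y ∷ ys) = y < x ⊎ (x ≡ y × xs ≻ ys)

≻-asym : ∀ {n} → Asymmetric (_≻_ {n})
≻-asym {x = []} {[]} ()
≻-asym {x = _ ∷ _} {_ ∷ _} (inj₁ y<x) (inj₁ x<y) = <-asym y<x x<y
≻-asym {x = _ ∷ _} {_ ∷ _} (inj₁ y<x) (inj₂ (refl , _)) = <-irrefl refl y<x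
≻-asym {x = _ ∷ _} {_ ∷ _} (inj₂ (refl , _)) (inj₁ x<y) = <-irrefl refl x<y
≻-asym {x = _ ∷ _} {_ ∷ _} (inj₂ (refl , xs≻ys)) (inj₂ (_ , ys≻xs)) = ≻-asym xs≻ys ys≻xs

≻-irrefl : ∀ {n} {u : Vec ℕ n} → ¬ (u ≻ u)
≻-irrefl u≻u = ≻-asym u≻u u≻u

≻-trans : ∀ {n} → Transitive (_≻_ {n})
≻-trans {i = []} {[]} {[]} ()
≻-trans {i = _ ∷ _} {_ ∷ _} {_ ∷ _} (inj₁ a) (inj₁ b) = inj₁ (<-trans b a)
≻-trans {i = _ ∷ _} {_ ∷ _} {_ ∷ _} (inj₁ a) (inj₂ (refl , _)) = inj₁ a
≻-trans {i = _ ∷ _} {_ ∷ _} {_ ∷ _} (inj₂ (refl , _)) (inj₁ b) = inj₁ b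
≻-trans {i = _ ∷ _} {_ ∷ _} {_ ∷ _} (inj₂ (refl , a)) (inj₂ (refl , b)) = inj₂ (refl , ≻-trans a b)

tri-greater : ∀ {n} {u v : Vec ℕ n} → u ≻ v → Tri (u ≻ v) (u ≡ v) (v ≻ u)
tri-greater u≻v = tri< u≻v (λ { refl → ≻-irrefl u≻v }) (≻-asym u≻v)

tri-smaller : ∀ {n} {u v : Vec ℕ n} → v ≻ u → Tri (u ≻ v) (u ≡ v) (v ≻ u)
tri-smaller v≻u = tri> (λ u≻v → ≻-asym u≻v v≻u) (λ { refl → ≻-irrefl v≻u }) v≻u

≻-compare : ∀ {n} → Trichotomous _≡_ (_≻_ {n})
≻-compare [] [] = tri≈ ≻-irrefl refl ≻-irrefl
≻-compare (x ∷ xs) (y ∷ ys) with <-cmp y x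
... | tri< y<x _ _ = tri-greater (inj₁ y<x)
... | tri> _ _ x<y = tri-smaller (inj₁ x<y)
... | tri≈ _ refl _ with ≻-compare xs ys
...   | tri< xs≻ys _ _ = tri-greater (inj₂ (refl , xs≻ys))
...   | tri≈ _ refl _ = tri≈ ≻-irrefl refl ≻-irrefl
...   | tri> _ _ ys≻xs = tri-smaller (inj₂ (refl , ys≻xs))

_≻?_ : ∀ {n} (u v : Vec ℕ n) → Dec (u ≻ v)
u ≻? v with ≻-compare u v
... | tri< u≻v _ _ = yes u≻v
... | tri≈ ¬u≻v _ _ = no ¬u≻v
... | tri> ¬u≻v _ _ = no ¬u≻v

record FirstDiff {n} (u v : Vec ℕ n) (i : Fin n) : Set where
  constructor firstDiff
  field
    agree   : ∀ j → j Fin.< i → lookup u j ≡ lookup v j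
    exceeds : lookup v i < lookup u i

FirstDiff⇒≻ : ∀ {n} {u v : Vec ℕ n} i → FirstDiff u v i → u ≻ v
FirstDiff⇒≻ {u = x ∷ u} {y ∷ v} zero (firstDiff _ y<x) = inj₁ y<x
FirstDiff⇒≻ {u = x ∷ u} {y ∷ v} (suc i) (firstDiff same lt) =
  inj₂ (same zero z<s , FirstDiff⇒≻ i (firstDiff (λ j j<i → same (suc j) (s≤s j<i)) lt))

≻⇒FirstDiff : ∀ {n} {u v : Vec ℕ n} → u ≻ v → ∃[ i ] FirstDiff u v i
≻⇒FirstDiff {u = []} {[]} ()
≻⇒FirstDiff {u = x ∷ u} {y ∷ v} (inj₁ y<x) = zero , firstDiff (λ j ()) y<x
≻⇒FirstDiff {u = x ∷ u} {y ∷ v} (inj₂ (refl , u≻v)) with ≻⇒FirstDiff u≻v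
... | i , firstDiff same lt = suc i , firstDiff (λ { zero _ → refl ; (suc j) (s≤s j<i) → same j j<i }) lt

first-diff-before : ∀ {n} {u v : Vec ℕ n} {i p} → FirstDiff u v i →
                    p ≢ i → lookup u p ≢ lookup v p → i Fin.< p
first-diff-before {i = i} {p} (firstDiff same _) p≢i differ with FinP.<-cmp i p
... | tri< i<p _ _ = i<p
... | tri≈ _ i≡p _ = ⊥-elim (p≢i (sym i≡p))
... | tri> _ _ p<i = ⊥-elim (differ (same p p<i))

before-≢ : ∀ {n} {j i p : Fin n} → j Fin.< i → i Fin.< p → j ≢ p
before-≢ j<i i<p = FinP.<⇒≢ (FinP.<-trans j<i i<p)

-- Lists sorted by an asymmetric relation ⊏ (earlier elements ⊏ later ones)

module SortedLists {A : Set} {_⊏_ : A → A → Set} (⊏-asym : Asymmetric _⊏_) where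

  first-satisfying : ∀ {P : A → Set} → Decidable P → ∀ {xs x} → AllPairs _⊏_ xs → x ∈ xs → P x →
                     ∃[ b ] (b ∈ xs × P b × (∀ {y} → y ∈ xs → y ⊏ b → ¬ P y))
  first-satisfying P? {h ∷ t} (h⊏t ∷ sorted) x∈xs px with P? h
  ... | yes ph = h , here refl , ph , earlier
    where
    earlier : ∀ {y} → y ∈ h ∷ t → y ⊏ h → ¬ _
    earlier (here refl) h⊏h = ⊥-elim (⊏-asym h⊏h h⊏h)
    earlier (there y∈t) y⊏h = ⊥-elim (⊏-asym (All.lookup h⊏t y∈t) y⊏h)
  first-satisfying P? {h ∷ t} (h⊏t ∷ sorted) (here refl) px | no ¬ph = ⊥-elim (¬ph px)
  first-satisfying P? {h ∷ t} (h⊏t ∷ sorted) (there x∈t) px | no ¬ph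
    with first-satisfying P? sorted x∈t px
  ... | b , b∈t , pb , earlier = b , there b∈t , pb , earlier′
    where
    earlier′ : ∀ {y} → y ∈ h ∷ t → y ⊏ b → ¬ _
    earlier′ (here refl) _ = ¬ph
    earlier′ (there y∈t) = earlier y∈t

  take-closed : ∀ n {xs x y} → AllPairs _⊏_ xs → x ∈ take n xs → y ∈ xs →
                y ≡ x ⊎ y ⊏ x → y ∈ take n xs
  take-closed (suc n) {h ∷ t} _ _ (here refl) _ = here refl
  take-closed (suc n) {h ∷ t} (h⊏t ∷ _) (here refl) (there y∈t) (inj₁ refl) =
    ⊥-elim (⊏-asym (All.lookup h⊏t y∈t) (All.lookup h⊏t y∈t))
  take-closed (suc n) {h ∷ t} (h⊏t ∷ _) (here refl) (there y∈t) (inj₂ y⊏h) =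
    ⊥-elim (⊏-asym (All.lookup h⊏t y∈t) y⊏h)
  take-closed (suc n) {h ∷ t} (_ ∷ sorted) (there x∈t) (there y∈t) rel =
    there (take-closed n sorted x∈t y∈t rel)

  lookup-injective : ∀ {xs} → AllPairs _⊏_ xs → (k k' : Fin (length xs)) →
                     List.lookup xs k ≡ List.lookup xs k' → k ≡ k'
  lookup-injective {h ∷ t} _ zero zero _ = refl
  lookup-injective {h ∷ t} (h⊏t ∷ _) zero (suc k') refl =
    ⊥-elim (⊏-asym (All.lookup h⊏t (∈-lookup k')) (All.lookup h⊏t (∈-lookup k')))
  lookup-injective {h ∷ t} (h⊏t ∷ _) (suc k) zero refl =
    ⊥-elim (⊏-asym (All.lookup h⊏t (∈-lookup k)) (All.lookup h⊏t (∈-lookup k)))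
  lookup-injective {h ∷ t} (_ ∷ sorted) (suc k) (suc k') same =
    cong suc (lookup-injective sorted k k' same)

module Sorting {A : Set} {_⊏_ : A → A → Set} (compare : Trichotomous _≡_ _⊏_) (⊏-trans : Transitive _⊏_) where

  insert : A → List A → List A
  insert x [] = x ∷ []
  insert x (h ∷ t) with compare x h
  ... | tri< _ _ _ = x ∷ h ∷ t
  ... | tri≈ _ _ _ = h ∷ t
  ... | tri> _ _ _ = h ∷ insert x t

  ∈-insert⁻ : ∀ {x y} t → y ∈ insert x t → y ≡ x ⊎ y ∈ t
  ∈-insert⁻ [] (here y≡x) = inj₁ y≡x
  ∈-insert⁻ {x} (h ∷ t) y∈ with compare x h
  ∈-insert⁻ {x} (h ∷ t) (here y≡x) | tri< _ _ _ = inj₁ y≡x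
  ∈-insert⁻ {x} (h ∷ t) (there y∈) | tri< _ _ _ = inj₂ y∈
  ... | tri≈ _ _ _ = inj₂ y∈
  ∈-insert⁻ {x} (h ∷ t) (here y≡h) | tri> _ _ _ = inj₂ (here y≡h)
  ∈-insert⁻ {x} (h ∷ t) (there y∈) | tri> _ _ _ with ∈-insert⁻ t y∈
  ... | inj₁ y≡x = inj₁ y≡x
  ... | inj₂ y∈t = inj₂ (there y∈t)

  ∈-insert⁺ˡ : ∀ x t → x ∈ insert x t
  ∈-insert⁺ˡ x [] = here refl
  ∈-insert⁺ˡ x (h ∷ t) with compare x h
  ... | tri< _ _ _ = here refl
  ... | tri≈ _ x≡h _ = here x≡h
  ... | tri> _ _ _ = there (∈-insert⁺ˡ x t)

  ∈-insert⁺ʳ : ∀ x {y} t → y ∈ t → y ∈ insert x t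
  ∈-insert⁺ʳ x (h ∷ t) y∈ with compare x h
  ... | tri< _ _ _ = there y∈
  ... | tri≈ _ _ _ = y∈
  ∈-insert⁺ʳ x (h ∷ t) (here y≡h) | tri> _ _ _ = here y≡h
  ∈-insert⁺ʳ x (h ∷ t) (there y∈t) | tri> _ _ _ = there (∈-insert⁺ʳ x t y∈t)

  insert-sorted : ∀ x t → AllPairs _⊏_ t → AllPairs _⊏_ (insert x t)
  insert-sorted x [] _ = [] ∷ []
  insert-sorted x (h ∷ t) (h⊏t ∷ sorted) with compare x h
  ... | tri< x⊏h _ _ = (x⊏h ∷ All.map (⊏-trans x⊏h) h⊏t) ∷ h⊏t ∷ sorted
  ... | tri≈ _ _ _ = h⊏t ∷ sorted
  ... | tri> _ _ h⊏x = All.tabulate (h⊏ ∘ ∈-insert⁻ t) ∷ insert-sorted x t sorted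
    where
    h⊏ : ∀ {y} → y ≡ x ⊎ y ∈ t → h ⊏ y
    h⊏ (inj₁ refl) = h⊏x
    h⊏ (inj₂ y∈t) = All.lookup h⊏t y∈t

  sort : List A → List A
  sort = foldr insert []

  ∈-sort⁺ : ∀ {x} xs → x ∈ xs → x ∈ sort xs
  ∈-sort⁺ (h ∷ t) (here refl) = ∈-insert⁺ˡ h (sort t)
  ∈-sort⁺ (h ∷ t) (there x∈t) = ∈-insert⁺ʳ h (sort t) (∈-sort⁺ t x∈t)

  ∈-sort⁻ : ∀ {x} xs → x ∈ sort xs → x ∈ xs
  ∈-sort⁻ (h ∷ t) x∈ with ∈-insert⁻ (sort t) x∈
  ... | inj₁ refl = here refl
  ... | inj₂ x∈t = there (∈-sort⁻ t x∈t)

  sort-sorted : ∀ xs → AllPairs _⊏_ (sort xs)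
  sort-sorted [] = []
  sort-sorted (h ∷ t) = insert-sorted h (sort t) (sort-sorted t)

-- Maximal elements and the rank of a pure set of monomials

-- Every member of a finite set of monomials divides a maximal member:
-- take a multiple of maximal degree.
below-maximal : ∀ {r} (Γ : MonSet r) {z} → z ∈ Γ → ∃[ m ] (IsMaximal Γ m × z ∣ₘ m)
below-maximal Γ {z} z∈Γ = u , (u∈Γ , maximality) , z∣u
  where
  multiples = filter (z ∣?_) Γ
  u = argmax deg z multiples
  u∈Γ×z∣u : u ∈ Γ × z ∣ₘ u
  u∈Γ×z∣u = argmax-all deg (z∈Γ , ∣ₘ-refl {u = z}) (All.tabulate (∈-filter⁻ (z ∣?_)))
  u∈Γ = proj₁ u∈Γ×z∣u
  z∣u = proj₂ u∈Γ×z∣u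
  maximality : ∀ w → w ∈ Γ → u ∣ₘ w → w ≡ u
  maximality w w∈Γ u∣w = sym (divisor-of-same-degree {u = u} {w} u∣w
    (All.lookup (f[xs]≤f[argmax] z multiples) (∈-filter⁺ (z ∣?_) w∈Γ (∣ₘ-trans {u = z} {u} {w} z∣u u∣w))))

rank : ∀ {r} (Γ : MonSet r) → IsPure Γ →
       ∃[ d ] ((∀ u → u ∈ Γ → deg u ≤ d) × (∀ m → IsMaximal Γ m → deg m ≡ d))
rank [] _ = 0 , (λ u ()) , (λ m ())
rank Γ@(_ ∷ _) pure with below-maximal Γ (here refl)
... | m₀ , max₀ , _ = deg m₀ , bounded , (λ m max → pure m m₀ max max₀)
  where
  bounded : ∀ u → u ∈ Γ → deg u ≤ deg m₀
  bounded u u∈Γ with below-maximal Γ u∈Γ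
  ... | m , max , u∣m = ≤-trans (deg-mono {u = u} {m} u∣m) (≤-reflexive (pure m m₀ max max₀))

-- In an order ideal, an interval [x , y] below a member y is the box of
-- all z with x ∣ z ∣ y, isomorphic to the divisors of y / x.

box-is-MInterval : ∀ {r} {Γ : MonSet r} {x y} → IsOrderIdeal Γ → y ∈ Γ → x ∣ₘ y → IsMInterval Γ (x , y)
box-is-MInterval {r} {Γ} {x} {y} ideal y∈Γ x∣y =
  r , y ∸ₘ x , (_∸ₘ x) , (_+ₘ x) , into , onto , (λ z z∈ → back z (proj₁ (proj₂ z∈))) , forth , monotone
  where
  _∸ₘ_ _+ₘ_ : Monomial r → Monomial r → Monomial r
  u ∸ₘ v = zipWith _∸_ u v
  u +ₘ v = zipWith _+_ u v
  at∸ : ∀ u v i → lookup (u ∸ₘ v) i ≡ lookup u i ∸ lookup v i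
  at∸ u v i = lookup-zipWith _∸_ i u v
  at+ : ∀ u v i → lookup (u +ₘ v) i ≡ lookup u i + lookup v i
  at+ u v i = lookup-zipWith _+_ i u v

  ∸x-mono : ∀ u v → u ∣ₘ v → (u ∸ₘ x) ∣ₘ (v ∸ₘ x)
  ∸x-mono u v u∣v i = subst₂ _≤_ (sym (at∸ u x i)) (sym (at∸ v x i)) (∸-monoˡ-≤ (lookup x i) (u∣v i))

  back : ∀ z → x ∣ₘ z → (z ∸ₘ x) +ₘ x ≡ z
  back z x∣z = monomial-ext λ i → begin
    lookup ((z ∸ₘ x) +ₘ x) i       ≡⟨ at+ (z ∸ₘ x) x i ⟩
    lookup (z ∸ₘ x) i + lookup x i ≡⟨ cong (_+ lookup x i) (at∸ z x i) ⟩
    lookup z i ∸ lookup x i + lookup x i ≡⟨ m∸n+n≡m (x∣z i) ⟩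
    lookup z i ∎
    where open ≡-Reasoning

  forth : ∀ e → e ∣ₘ (y ∸ₘ x) → (e +ₘ x) ∸ₘ x ≡ e
  forth e _ = monomial-ext λ i →
    trans (at∸ (e +ₘ x) x i) (trans (cong (_∸ lookup x i) (at+ e x i)) (m+n∸n≡m (lookup e i) (lookup x i)))

  ∣-+x : ∀ e u → e ∣ₘ (u ∸ₘ x) → x ∣ₘ u → (e +ₘ x) ∣ₘ u
  ∣-+x e u e∣ x∣u i = begin
    lookup (e +ₘ x) i         ≡⟨ at+ e x i ⟩
    lookup e i + lookup x i   ≤⟨ +-monoˡ-≤ (lookup x i) (subst (lookup e i ≤_) (at∸ u x i) (e∣ i)) ⟩
    lookup u i ∸ lookup x i + lookup x i ≡⟨ m∸n+n≡m (x∣u i) ⟩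
    lookup u i ∎
    where open ≤-Reasoning

  x∣+x : ∀ e → x ∣ₘ (e +ₘ x)
  x∣+x e i = subst (lookup x i ≤_) (sym (at+ e x i)) (m≤n+m (lookup x i) (lookup e i))

  into : ∀ z → InInterval Γ (x , y) z → (z ∸ₘ x) ∣ₘ (y ∸ₘ x)
  into z (_ , _ , z∣y) = ∸x-mono z y z∣y

  onto : ∀ e → e ∣ₘ (y ∸ₘ x) → InInterval Γ (x , y) (e +ₘ x)
  onto e e∣ = ideal y (e +ₘ x) y∈Γ (∣-+x e y e∣ x∣y) , x∣+x e , ∣-+x e y e∣ x∣y

  monotone : ∀ z z' → InInterval Γ (x , y) z → InInterval Γ (x , y) z' →
             (z ∣ₘ z' → (z ∸ₘ x) ∣ₘ (z' ∸ₘ x)) × ((z ∸ₘ x) ∣ₘ (z' ∸ₘ x) → z ∣ₘ z')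
  monotone z z' (_ , x∣z , _) (_ , x∣z' , _) =
    ∸x-mono z z' , λ d → subst (_∣ₘ z') (back z x∣z) (∣-+x (z ∸ₘ x) z' d x∣z')

module PolymatroidShelling
  {r : ℕ} (Γ : MonSet r) (ideal : IsOrderIdeal Γ)
  (exchange : ∀ m m' (i : Fin r) → IsMaximal Γ m → IsMaximal Γ m' →
              lookup m' i < lookup m i → ∃[ j ] (lookup m j < lookup m' j × shift i j m ∈ Γ))
  (d : ℕ) (deg≤d : ∀ u → u ∈ Γ → deg u ≤ d) (maximal-deg : ∀ m → IsMaximal Γ m → deg m ≡ d)
  where

  IsBase : Monomial r → Set
  IsBase b = b ∈ Γ × deg b ≡ d

  base-maximal : ∀ {b} → IsBase b → IsMaximal Γ b
  base-maximal {b} (b∈Γ , deg≡d) = b∈Γ , λ u u∈Γ b∣u →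
    sym (divisor-of-same-degree {u = b} {u} b∣u (subst (deg u ≤_) (sym deg≡d) (deg≤d u u∈Γ)))

  base-divides-base : ∀ {b b'} → IsBase b → IsBase b' → b ∣ₘ b' → b ≡ b'
  base-divides-base {b} {b'} (_ , db) (_ , db') b∣b' =
    divisor-of-same-degree {u = b} {b'} b∣b' (≤-reflexive (trans db' (sym db)))

  shift-base : ∀ {b p q} → IsBase b → 0 < lookup b p → shift p q b ∈ Γ → IsBase (shift p q b)
  shift-base {b} {p} {q} (_ , db) pos shifted∈Γ = shifted∈Γ , trans (deg-shift b p q pos) db

  open Sorting (≻-compare {r}) ≻-trans using (sort; ∈-sort⁺; ∈-sort⁻; sort-sorted)

  candidates : List (Monomial r)
  candidates = filter (λ b → deg b ≟ d) Γ

  bases : List (Monomial r)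
  bases = sort candidates

  ∈-bases⁺ : ∀ {b} → IsBase b → b ∈ bases
  ∈-bases⁺ (b∈Γ , db) = ∈-sort⁺ candidates (∈-filter⁺ (λ b → deg b ≟ d) b∈Γ db)

  ∈-bases⁻ : ∀ {b} → b ∈ bases → IsBase b
  ∈-bases⁻ b∈ = ∈-filter⁻ (λ b → deg b ≟ d) (∈-sort⁻ candidates b∈)

  bases-sorted : AllPairs _≻_ bases
  bases-sorted = sort-sorted candidates

  Covered : Monomial r → Fin r → Set
  Covered b j = Any (λ b' → b' ≻ b × lower j b ∣ₘ b') bases

  covered? : ∀ b j → Dec (Covered b j)
  covered? b j = Any.any? (λ b' → (b' ≻? b) ×-dec (lower j b ∣? b')) bases

  excess : Monomial r → Monomial r → ℕ
  excess b b' = deg (zipWith _∸_ b' b)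

  -- Exchanging b towards b' at a coordinate p where b is larger must then
  -- raise coordinate i, producing an earlier basis divisible by b / x_p.
  key-direct : ∀ {b b' i} → IsBase b → IsBase b' → FirstDiff b' b i →
               (∀ p → p ≢ i → lookup b' p ≤ lookup b p) →
               ∃[ p ] (lookup b' p < lookup b p × Covered b p)
  key-direct {b} {b'} {i} base base' first@(firstDiff _ bi<b'i) below
    with FinP.¬∀⟶∃¬ r _ (λ k → lookup b k ≤? lookup b' k) (b≢b' ∘ base-divides-base base base')
    where
    b≢b' : b ≢ b'
    b≢b' refl = ≻-irrefl (FirstDiff⇒≻ i first)
  ... | p , ¬bp≤b'p with exchange b b' p (base-maximal base) (base-maximal base') (≰⇒> ¬bp≤b'p)
  ... | q , bq<b'q , shifted∈Γ with q FinP.≟ i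
  ... | no q≢i = ⊥-elim (<⇒≱ bq<b'q (below q q≢i))
  ... | yes refl = p , b'p<bp , lose (∈-bases⁺ base₂) (FirstDiff⇒≻ q first₂ , ∣ₘ-raise (lower p b) q)
    where
    b'p<bp = ≰⇒> ¬bp≤b'p
    p≢q : p ≢ q
    p≢q refl = <-asym bi<b'i b'p<bp
    q<p : q Fin.< p
    q<p = first-diff-before first p≢q (<⇒≢ b'p<bp)
    base₂ : IsBase (shift p q b)
    base₂ = shift-base base (≤-trans z<s b'p<bp) shifted∈Γ
    first₂ : FirstDiff (shift p q b) b q
    first₂ = firstDiff (λ j j<q → lookup-shift-other b (before-≢ j<q q<p) (FinP.<⇒≢ j<q))
             (subst (lookup b q <_) (sym (lookup-shift-target b p≢q)) (n<1+n _))

  -- Key lemma, inductive case: b' exceeds b at some p ≠ i.  Exchanging b'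
  -- towards b at p gives an earlier-than-b basis b″ with smaller excess
  -- over b, and wherever b″ is below b so is b'.
  key-approach : ∀ {b b' i p} → IsBase b → IsBase b' → FirstDiff b' b i →
                 p ≢ i → lookup b p < lookup b' p →
                 ∃[ b″ ] (IsBase b″ × b″ ≻ b × excess b b″ < excess b b' ×
                          (∀ k → lookup b″ k < lookup b k → lookup b' k < lookup b k))
  key-approach {b} {b'} {i} {p} base base' first@(firstDiff same bi<b'i) p≢i bp<b'p
    with exchange b' b p (base-maximal base') (base-maximal base) bp<b'p
  ... | q , b'q<bq , shifted∈Γ =
    b″ , shift-base base' (≤-trans z<s bp<b'p) shifted∈Γ , FirstDiff⇒≻ i first″ , smaller , still-below
    where
    b″ = shift p q b'
    p≢q : p ≢ q
    p≢q refl = <-asym bp<b'p b'q<bq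
    q≢i : q ≢ i
    q≢i refl = <-asym bi<b'i b'q<bq
    i<p : i Fin.< p
    i<p = first-diff-before first p≢i (≢-sym (<⇒≢ bp<b'p))
    i<q : i Fin.< q
    i<q = first-diff-before first q≢i (<⇒≢ b'q<bq)
    first″ : FirstDiff b″ b i
    first″ = firstDiff
      (λ j j<i → trans (lookup-shift-other b' (before-≢ j<i i<p) (before-≢ j<i i<q)) (same j j<i))
      (subst (lookup b i <_) (sym (lookup-shift-other b' (FinP.<⇒≢ i<p) (FinP.<⇒≢ i<q))) bi<b'i)
    at-p : lookup b″ p ≡ pred (lookup b' p)
    at-p = lookup-shift-source b' p≢q
    at-q : lookup b″ q ≡ suc (lookup b' q)
    at-q = lookup-shift-target b' p≢q
    at-other : ∀ {k} → k ≢ p → k ≢ q → lookup b″ k ≡ lookup b' k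
    at-other = lookup-shift-other b'
    excess-at : ∀ v k → lookup (zipWith _∸_ v b) k ≡ lookup v k ∸ lookup b k
    excess-at v k = lookup-zipWith _∸_ k v b
    excess-pointwise : ∀ k → lookup b″ k ∸ lookup b k ≤ lookup b' k ∸ lookup b k
    excess-pointwise k with k FinP.≟ p | k FinP.≟ q
    ... | yes refl | _ = subst (λ e → e ∸ lookup b k ≤ _) (sym at-p) (∸-monoˡ-≤ (lookup b k) pred[n]≤n)
    ... | no _ | yes refl = subst (_≤ lookup b' k ∸ lookup b k) (sym (trans (cong (_∸ lookup b k) at-q) (m≤n⇒m∸n≡0 b'q<bq))) z≤n
    ... | no k≢p | no k≢q = ≤-reflexive (cong (_∸ lookup b k) (at-other k≢p k≢q))
    pred< : ∀ {n} → 0 < n → pred n < n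
    pred< {suc n} _ = n<1+n n
    excess-drops-at-p : lookup b″ p ∸ lookup b p < lookup b' p ∸ lookup b p
    excess-drops-at-p = subst (λ e → e ∸ lookup b p < _) (sym at-p)
      (∸-monoˡ-< (pred< (≤-trans z<s bp<b'p)) (pred-mono-≤ bp<b'p))
    smaller : excess b b″ < excess b b'
    smaller = deg-strict {u = zipWith _∸_ b″ b} {zipWith _∸_ b' b} p
      (λ k → subst₂ _≤_ (sym (excess-at b″ k)) (sym (excess-at b' k)) (excess-pointwise k))
      (subst₂ _<_ (sym (excess-at b″ p)) (sym (excess-at b' p)) excess-drops-at-p)
    still-below : ∀ k → lookup b″ k < lookup b k → lookup b' k < lookup b k
    still-below k b″k<bk with k FinP.≟ p | k FinP.≟ q
    ... | yes refl | _ = ⊥-elim (<⇒≱ (subst (_< lookup b k) at-p b″k<bk) (pred-mono-≤ bp<b'p))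
    ... | no _ | yes refl = b'q<bq
    ... | no k≢p | no k≢q = subst (_< lookup b k) (at-other k≢p k≢q) b″k<bk

  key : ∀ {b b'} → IsBase b → IsBase b' → b' ≻ b → ∃[ p ] (lookup b' p < lookup b p × Covered b p)
  key {b} {b'} base base' = go (<-wellFounded (excess b b')) base'
    where
    go : ∀ {b'} → Acc _<_ (excess b b') → IsBase b' → b' ≻ b → ∃[ p ] (lookup b' p < lookup b p × Covered b p)
    go {b'} (acc smaller) base' b'≻b with ≻⇒FirstDiff b'≻b
    ... | i , first with FinP.any? (λ p → ¬? (p FinP.≟ i) ×-dec (lookup b p <? lookup b' p))
    ... | no none = key-direct base base' first (λ p p≢i → ≮⇒≥ (λ lt → none (p , p≢i , lt)))
    ... | yes (p , p≢i , bp<b'p) with key-approach base base' first p≢i bp<b'p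
    ... | b″ , base″ , b″≻b , closer , still-below with go (smaller closer) base″ b″≻b
    ... | p₀ , b″<b , covered = p₀ , still-below p₀ b″<b , covered

  covered-exponent : ∀ {P : Set} → Dec P → ℕ → ℕ
  covered-exponent (yes _) e = e
  covered-exponent (no _) _ = 0

  bottom : Monomial r → Monomial r
  bottom b = tabulate (λ j → covered-exponent (covered? b j) (lookup b j))

  bottom-exponent : ∀ b j → lookup (bottom b) j ≡ covered-exponent (covered? b j) (lookup b j)
  bottom-exponent b j = lookup∘tabulate (λ j → covered-exponent (covered? b j) (lookup b j)) j

  bottom-covered : ∀ {b j} → Covered b j → lookup (bottom b) j ≡ lookup b j
  bottom-covered {b} {j} cov with covered? b j | bottom-exponent b j
  ... | yes _ | at-j = at-j
  ... | no ¬cov | _ = ⊥-elim (¬cov cov)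

  bottom-uncovered : ∀ {b j} → ¬ Covered b j → lookup (bottom b) j ≡ 0
  bottom-uncovered {b} {j} ¬cov with covered? b j | bottom-exponent b j
  ... | yes cov | _ = ⊥-elim (¬cov cov)
  ... | no _ | at-j = at-j

  bottom∣ : ∀ b → bottom b ∣ₘ b
  bottom∣ b j with covered? b j
  ... | yes cov = ≤-reflexive (bottom-covered cov)
  ... | no ¬cov = subst (_≤ lookup b j) (sym (bottom-uncovered ¬cov)) z≤n

  interval : Monomial r → Monomial r × Monomial r
  interval b = bottom b , b

  -- If b is the first basis that z divides, then z lies in the interval of b:
  -- at a covered j, a smaller exponent would make z divide an earlier basis.
  first-basis-in-interval : ∀ {b z} → z ∈ Γ → z ∣ₘ b →
                            (∀ {b'} → b' ∈ bases → b' ≻ b → ¬ z ∣ₘ b') → InInterval Γ (interval b) z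
  first-basis-in-interval {b} {z} z∈Γ z∣b not-earlier = z∈Γ , bottom∣z , z∣b
    where
    bottom∣z : bottom b ∣ₘ z
    bottom∣z j with covered? b j
    ... | no ¬cov = subst (_≤ lookup z j) (sym (bottom-uncovered ¬cov)) z≤n
    ... | yes cov with find cov
    ... | b' , b'∈ , b'≻b , lower∣b' = subst (_≤ lookup z j) (sym (bottom-covered cov)) (≮⇒≥ λ zj<bj →
          not-earlier b'∈ b'≻b (∣ₘ-trans {u = z} {lower j b} {b'} (∣ₘ-lower {z = z} {b} j z∣b zj<bj) lower∣b'))

  interval-before-earlier : ∀ {b z b'} → IsBase b → InInterval Γ (interval b) z →
                            IsBase b' → b' ≻ b → ¬ z ∣ₘ b'
  interval-before-earlier {b} {z} {b'} base (_ , bottom∣z , _) base' b'≻b z∣b' with key base base' b'≻b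
  ... | p , b'p<bp , cov = <⇒≱ b'p<bp (begin
    lookup b p          ≡⟨ bottom-covered cov ⟨
    lookup (bottom b) p ≤⟨ bottom∣z p ⟩
    lookup z p          ≤⟨ z∣b' p ⟩
    lookup b' p         ∎)
    where open ≤-Reasoning

  open SortedLists {_⊏_ = _≻_ {r}} ≻-asym using (first-satisfying)

  assign : ∀ {z} → z ∈ Γ → ∃[ b ] (b ∈ bases × InInterval Γ (interval b) z)
  assign {z} z∈Γ with below-maximal Γ z∈Γ
  ... | m , max , z∣m with first-satisfying (z ∣?_) bases-sorted (∈-bases⁺ (proj₁ max , maximal-deg m max)) z∣m
  ... | b , b∈ , z∣b , not-earlier = b , b∈ , first-basis-in-interval z∈Γ z∣b not-earlier

  assign-unique : ∀ {z b b'} → b ∈ bases → b' ∈ bases →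
                  InInterval Γ (interval b) z → InInterval Γ (interval b') z → b ≡ b'
  assign-unique {b = b} {b'} b∈ b'∈ z∈I z∈I' with ≻-compare b b'
  ... | tri< b≻b' _ _ = ⊥-elim (interval-before-earlier (∈-bases⁻ b'∈) z∈I' (∈-bases⁻ b∈) b≻b' (proj₂ (proj₂ z∈I)))
  ... | tri≈ _ b≡b' _ = b≡b'
  ... | tri> _ _ b'≻b = ⊥-elim (interval-before-earlier (∈-bases⁻ b∈) z∈I (∈-bases⁻ b'∈) b'≻b (proj₂ (proj₂ z∈I')))

  shelling : List (Monomial r × Monomial r)
  shelling = map interval bases

  _≻ᵢ_ : Monomial r × Monomial r → Monomial r × Monomial r → Set
  _≻ᵢ_ = _≻_ on proj₂

  shelling-sorted : AllPairs _≻ᵢ_ shelling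
  shelling-sorted = AllPairs.map⁺ bases-sorted

  open SortedLists {_⊏_ = _≻ᵢ_} ≻-asym using (take-closed; lookup-injective)

  interval-properties : ∀ {I} → I ∈ shelling →
                        proj₁ I ∈ Γ × proj₁ I ∣ₘ proj₂ I × IsMaximal Γ (proj₂ I) × IsMInterval Γ I
  interval-properties I∈ with ∈-map⁻ interval I∈
  ... | b , b∈ , refl =
    ideal b (bottom b) b∈Γ (bottom∣ b) , bottom∣ b , base-maximal base , box-is-MInterval {x = bottom b} ideal b∈Γ (bottom∣ b)
    where
    base = ∈-bases⁻ b∈
    b∈Γ = proj₁ base

  is-partition : IsMPartition Γ shelling
  is-partition = (λ k → interval-properties (∈-lookup k)) , covering , disjoint
    where
    covering : ∀ z → z ∈ Γ → ∃[ k ] InInterval Γ (List.lookup shelling k) z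
    covering z z∈Γ with assign z∈Γ
    ... | b , b∈ , z∈I = Any.index I∈ , subst (λ I → InInterval Γ I z) (lookup-index I∈) z∈I
      where I∈ = ∈-map⁺ interval b∈
    disjoint : ∀ z (k k' : Fin (length shelling)) → InInterval Γ (List.lookup shelling k) z →
               InInterval Γ (List.lookup shelling k') z → k ≡ k'
    disjoint z k k' z∈I z∈I'
      with ∈-map⁻ interval (∈-lookup {xs = shelling} k) | ∈-map⁻ interval (∈-lookup {xs = shelling} k')
    ... | b , b∈ , Iₖ≡ | b' , b'∈ , Iₖ'≡ = lookup-injective shelling-sorted k k'
      (trans Iₖ≡ (trans (cong interval same-basis) (sym Iₖ'≡)))
      where
      same-basis : b ≡ b'
      same-basis = assign-unique b∈ b'∈ (subst (λ I → InInterval Γ I z) Iₖ≡ z∈I) (subst (λ I → InInterval Γ I z) Iₖ'≡ z∈I')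

  -- A divisor v of a member z of the first n intervals is assigned to an
  -- interval no later than that of z.
  prefix-closed : ∀ n z v → InUnion Γ (take n shelling) z → v ∈ Γ → v ∣ₘ z → InUnion Γ (take n shelling) v
  prefix-closed n z v z∈U v∈Γ v∣z with find z∈U
  ... | I , I∈prefix , z∈I with ∈-map⁻ interval (Sublist.lookup (take-⊆ n shelling) I∈prefix)
  ... | b , b∈ , refl with assign v∈Γ
  ... | b* , b*∈ , v∈I* = lose (take-closed n shelling-sorted I∈prefix (∈-map⁺ interval b*∈) no-later) v∈I*
    where
    no-later : interval b* ≡ interval b ⊎ b* ≻ b
    no-later with ≻-compare b* b
    ... | tri< b*≻b _ _ = inj₂ b*≻b
    ... | tri≈ _ refl _ = inj₁ refl
    ... | tri> _ _ b≻b* = ⊥-elim (interval-before-earlier (∈-bases⁻ b*∈) v∈I* (∈-bases⁻ b∈) b≻b*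
                                    (∣ₘ-trans {u = v} {z} {b} v∣z (proj₂ (proj₂ z∈I))))

  is-shelling : IsMShelling Γ shelling
  is-shelling = is-partition , prefix-closed

theorem2p1 : (r : ℕ) (Γ : MonSet r) → IsDiscretePolymatroid Γ → IsMShellable Γ
theorem2p1 r Γ (ideal , pure , exchange) with rank Γ pure
... | d , deg≤d , maximal-deg = shelling , is-shelling
  where open PolymatroidShelling Γ ideal exchange d deg≤d maximal-deg
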